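{- Let $S\neq0$ be a commutative ring with a conjugation, and let $\mathscr{S}_*$ be the set of $|\psi\rangle\in\mathscr{D}$ for which there exists $|\phi\rangle\in\mathscr{D}$ with $\langle\phi|\psi\rangle=1_S$. Then $\mathscr{S}_*$ is a state space.
   Context: A conjugation on $S$ is a ring automorphism $s\mapsto\bar s$ with $\bar{\bar s}=s$. $\mathcal{B}=S^{\{0,1\}}$, $\mathscr{D}=S\oplus\mathcal{B}\oplus\mathcal{B}^{\otimes2}\oplus\cdots$ with $\mathcal{B}^{\otimes n}\cong S^{\{0,1\}^n}$ having standard basis $|x\rangle$, $x\in\{0,1\}^n$; $\vec 0$ is the zero vector; $\otimes$ is the tensor (Kronecker) product; $\langle\phi|\psi\rangle=\sum_x\bar\phi_x\psi_x$. A state space is a subset $\mathscr{S}\subseteq\mathscr{D}$ such that (1) for $|\psi\rangle\in\mathscr{S}$ and $|\phi\rangle\in\mathscr{D}$, $|\phi\rangle\otimes|\psi\rangle\in\mathscr{S}$ iff $|\phi\rangle\in\mathscr{S}$, and $|\psi\rangle\otimes|\phi\rangle\in\mathscr{S}$ iff $|\phi\rangle\in\mathscr{S}$; (2) $\mathscr{S}$ contains $|x\rangle$ for every $x\in\{0,1\}^*$ and does not contain $\vec0$. -}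

module Defs where

open import Level using (Level)
open import Data.Bool using (Bool; true; false; if_then_else_)
open import Data.Nat using (ℕ; zero; suc; _<ᵇ_) renaming (_+_ to _+ℕ_; _⊔_ to _⊔ℕ_)
open import Data.List using (List; []; _∷_; map; concatMap; length; _++_)
open import Data.List.Properties using (≡-dec)
open import Data.Bool.Properties using () renaming (_≟_ to _≟B_)
open import Data.Product using (_×_; _,_; Σ)
open import Relation.Nullary using (¬_; does)
open import Algebra.Bundles using (CommutativeRing)
open import Algebra.Morphism.Structures using (module RingMorphisms)

record IsConjugation {c ℓ} (R : CommutativeRing c ℓ)
         (conj : CommutativeRing.Carrier R → CommutativeRing.Carrier R) : Set (c Level.⊔ ℓ) where
  open CommutativeRing R
  open RingMorphisms rawRing rawRing
  field
    isRingIsomorphism : IsRingIsomorphism conj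
    involutive        : ∀ s → conj (conj s) ≈ s

words : ℕ → List (List Bool)
words zero    = [] ∷ []
words (suc n) = concatMap (λ w → (false ∷ w) ∷ (true ∷ w) ∷ []) (words n)

wordsBelow : ℕ → List (List Bool)
wordsBelow zero    = []
wordsBelow (suc n) = wordsBelow n ++ words n

splits : List Bool → List (List Bool × List Bool)
splits []      = ([] , []) ∷ []
splits (b ∷ z) = ([] , b ∷ z) ∷ map (λ { (x , y) → (b ∷ x , y) }) (splits z)

_==_ : List Bool → List Bool → Bool
x == y = does (≡-dec _≟B_ x y)

module Qubits {c ℓ} (R : CommutativeRing c ℓ) where
  open CommutativeRing R

  sumS : List Carrier → Carrier
  sumS []       = 0#
  sumS (s ∷ ss) = s + sumS ss

  -- An element of 𝒟 = S ⊕ ℬ ⊕ ℬ^{⊗2} ⊕ ⋯ , i.e. a finitely supported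
  -- family of coefficients indexed by {0,1}^*.  It is represented by a
  -- degree bound `bound` and raw coefficients `raw`; the actual coefficient
  -- at x is `raw x` if length x < bound, and 0 otherwise.
  record 𝒟 : Set c where
    constructor mk𝒟
    field
      bound : ℕ
      raw   : List Bool → Carrier

  open 𝒟 public

  coeff : 𝒟 → List Bool → Carrier
  coeff ψ x = if length x <ᵇ bound ψ then raw ψ x else 0#

  _≈𝒟_ : 𝒟 → 𝒟 → Set ℓ
  φ ≈𝒟 ψ = ∀ x → coeff φ x ≈ coeff ψ x

  zero𝒟 : 𝒟
  zero𝒟 = mk𝒟 0 (λ _ → 0#)

  ket : List Bool → 𝒟
  ket x = mk𝒟 (suc (length x)) (λ z → if z == x then 1# else 0#)

  _⊗_ : 𝒟 → 𝒟 → 𝒟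
  φ ⊗ ψ = mk𝒟 (bound φ +ℕ bound ψ)
            (λ z → sumS (map (λ { (x , y) → coeff φ x * coeff ψ y }) (splits z)))

  record IsStateSpace {p} (𝒮 : 𝒟 → Set p) : Set (c Level.⊔ ℓ Level.⊔ p) where
    field
      tensorˡ : ∀ ψ → 𝒮 ψ → ∀ φ → (𝒮 (φ ⊗ ψ) → 𝒮 φ) × (𝒮 φ → 𝒮 (φ ⊗ ψ))
      tensorʳ : ∀ ψ → 𝒮 ψ → ∀ φ → (𝒮 (ψ ⊗ φ) → 𝒮 φ) × (𝒮 φ → 𝒮 (ψ ⊗ φ))
      kets    : ∀ x → 𝒮 (ket x)
      noZero  : ∀ ψ → ψ ≈𝒟 zero𝒟 → ¬ 𝒮 ψ

  module WithConj (conj : Carrier → Carrier) where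
    ⟨_∣_⟩ : 𝒟 → 𝒟 → Carrier
    ⟨ φ ∣ ψ ⟩ = sumS (map (λ x → conj (coeff φ x) * coeff ψ x)
                          (wordsBelow (bound φ ⊔ℕ bound ψ)))

    𝒮* : 𝒟 → Set (c Level.⊔ ℓ)
    𝒮* ψ = Σ 𝒟 (λ φ → ⟨ φ ∣ ψ ⟩ ≈ 1#)

-- Since the conjugation is an involution, a witness φ for ψ ∈ 𝒮* is just a choice of
-- coefficients, so 𝒮* consists of the unimodular vectors: those whose coefficients generate
-- the unit ideal. The tensor product is the product of the free algebra S⟨0,1⟩, and its
-- coefficients lie in the ideals generated by the coefficients of either factor; this gives
-- one direction of each tensor condition. The other direction is Gauss's lemma for S⟨0,1⟩,
-- proved constructively by induction on the degree of f: modulo an ideal J containing all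
-- coefficients of fg, a coefficient a of f of top degree satisfies aᵐg ≡ 0 for large m, so
-- a is nilpotent modulo J because g is unimodular. Adjoining the top coefficients to J
-- lowers the degree of f, and nilpotent elements can be dropped from a unimodular family.
module Submission where

open import Defs
open import Algebra.Bundles using (CommutativeRing; CommutativeSemiring)
open import Data.Bool using (Bool; true; false; if_then_else_)
open import Data.Empty using (⊥-elim)
open import Data.List using (List; []; _∷_; map; concatMap; length; _++_)
open import Data.List.Properties using (map-∘; length-++-≤ʳ; ∷-injectiveʳ; ≡-dec)
open import Data.Bool.Properties using () renaming (_≟_ to _≟B_)
open import Data.Nat using (ℕ; zero; suc; _<ᵇ_; _≤_; _<_; z≤n; s≤s)
  renaming (_+_ to _+ℕ_; _⊔_ to _⊔ℕ_)
open import Data.Nat.Properties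
  using (_<?_; <ᵇ-reflects-<; ≮⇒≥; <⇒≱; <⇒≤; <⇒≢; ≤∧≢⇒<; m≤n⇒m<n∨m≡n; +-mono-<;
         n<1+n; m≤m⊔n; suc-injective; ≤-reflexive; ≤-trans)
  renaming (_≟_ to _≟ℕ_)
open import Data.Product using (Σ; ∃; ∃₂; _×_; _,_; proj₁; proj₂)
open import Data.Sum using (inj₁; inj₂)
open import Data.Unit using (⊤)
open import Function using (id; _∘_)
open import Level using (_⊔_; Lift; lift) renaming (suc to lsuc)
open import Relation.Binary.PropositionalEquality as ≡ using (_≡_; _≢_)
open import Relation.Nullary using (¬_; yes; no)
open import Relation.Nullary.Decidable using (dec-true; dec-false)
open import Relation.Nullary.Reflects using (ofʸ; ofⁿ)

module _ {c ℓ} (R : CommutativeRing c ℓ) where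
  open CommutativeRing R
  open import Algebra.Definitions.RawSemiring (CommutativeSemiring.rawSemiring commutativeSemiring) using (_^_)
  open import Algebra.Properties.CommutativeSemiring.Exp commutativeSemiring using (^-distrib-*)
  open import Algebra.Properties.CommutativeSemigroup +-commutativeSemigroup using (interchange)
  open import Algebra.Properties.CommutativeSemigroup *-commutativeSemigroup
    using (x∙yz≈y∙xz; x∙yz≈yx∙z)
  open import Algebra.Properties.AbelianGroup +-abelianGroup using (//-rightDividesʳ)
  open import Algebra.Properties.Ring ring using (-1*x≈-x)
  open import Relation.Binary.Reasoning.Setoid setoid
  open Qubits R

  ∑ : ∀ {a} {A : Set a} → List A → (A → Carrier) → Carrier
  ∑ L F = sumS (map F L)

  module _ {a} {A : Set a} where

    ∑-cong : ∀ {F G : A → Carrier} L → (∀ x → F x ≈ G x) → ∑ L F ≈ ∑ L G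
    ∑-cong []      F≈G = refl
    ∑-cong (x ∷ L) F≈G = +-cong (F≈G x) (∑-cong L F≈G)

    ∑-zero : ∀ {F : A → Carrier} L → (∀ x → F x ≈ 0#) → ∑ L F ≈ 0#
    ∑-zero []      F≈0 = refl
    ∑-zero (x ∷ L) F≈0 = trans (+-cong (F≈0 x) (∑-zero L F≈0)) (+-identityˡ 0#)

    ∑-distrib-+ : ∀ (F G : A → Carrier) L → ∑ L (λ x → F x + G x) ≈ ∑ L F + ∑ L G
    ∑-distrib-+ F G []      = sym (+-identityˡ 0#)
    ∑-distrib-+ F G (x ∷ L) =
      trans (+-congˡ (∑-distrib-+ F G L)) (interchange (F x) (G x) (∑ L F) (∑ L G))

    ∑-distribˡ-* : ∀ r (F : A → Carrier) L → ∑ L (λ x → r * F x) ≈ r * ∑ L F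
    ∑-distribˡ-* r F []      = sym (zeroʳ r)
    ∑-distribˡ-* r F (x ∷ L) = trans (+-congˡ (∑-distribˡ-* r F L)) (sym (distribˡ r (F x) (∑ L F)))

    ∑-++ : ∀ (F : A → Carrier) L M → ∑ (L ++ M) F ≈ ∑ L F + ∑ M F
    ∑-++ F []      M = sym (+-identityˡ (∑ M F))
    ∑-++ F (x ∷ L) M = trans (+-congˡ (∑-++ F L M)) (sym (+-assoc (F x) (∑ L F) (∑ M F)))

  ∑-map : ∀ {a b} {A : Set a} {B : Set b} (F : B → Carrier) (h : A → B) L →
          ∑ (map h L) F ≡ ∑ L (λ x → F (h x))
  ∑-map F h L = ≡.cong sumS (≡.sym (map-∘ L))

  -- Ideals

  record Ideal : Set (lsuc (c ⊔ ℓ)) where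
    field
      Member    : Carrier → Set (c ⊔ ℓ)
      ∈-resp-≈  : ∀ {a b} → a ≈ b → Member a → Member b
      0∈        : Member 0#
      +-closed  : ∀ {a b} → Member a → Member b → Member (a + b)
      *-closedˡ : ∀ r {a} → Member a → Member (r * a)

  open Ideal public

  infix 4 _∈_ _⊆_
  _∈_ : Carrier → Ideal → Set (c ⊔ ℓ)
  a ∈ J = Member J a

  _⊆_ : Ideal → Ideal → Set (c ⊔ ℓ)
  J ⊆ K = ∀ {a} → a ∈ J → a ∈ K

  module _ (J : Ideal) where

    ≈0⇒∈ : ∀ {a} → a ≈ 0# → a ∈ J
    ≈0⇒∈ a≈0 = ∈-resp-≈ J (sym a≈0) (0∈ J)

    ∑-closed : ∀ {a} {A : Set a} (F : A → Carrier) L → (∀ x → F x ∈ J) → ∑ L F ∈ J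
    ∑-closed F []      F∈J = 0∈ J
    ∑-closed F (x ∷ L) F∈J = +-closed J (F∈J x) (∑-closed F L F∈J)

    ∈-cancelʳ : ∀ {a b} → b ∈ J → a + b ∈ J → a ∈ J
    ∈-cancelʳ {a} {b} b∈J a+b∈J =
      ∈-resp-≈ J (//-rightDividesʳ b a)
        (+-closed J a+b∈J (∈-resp-≈ J (-1*x≈-x b) (*-closedˡ J (- 1#) b∈J)))

    ∈-cancelˡ : ∀ {a b} → a ∈ J → a + b ∈ J → b ∈ J
    ∈-cancelˡ {a} {b} a∈J a+b∈J = ∈-cancelʳ a∈J (∈-resp-≈ J (+-comm a b) a+b∈J)

  0ᴵ : Ideal
  0ᴵ = record
    { Member    = λ a → Lift c (a ≈ 0#)
    ; ∈-resp-≈  = λ { a≈b (lift a≈0) → lift (trans (sym a≈b) a≈0) }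
    ; 0∈        = lift refl
    ; +-closed  = λ { (lift a≈0) (lift b≈0) → lift (trans (+-cong a≈0 b≈0) (+-identityˡ 0#)) }
    ; *-closedˡ = λ { r (lift a≈0) → lift (trans (*-congˡ a≈0) (zeroʳ r)) }
    }

  0ᴵ⊆ : ∀ J → 0ᴵ ⊆ J
  0ᴵ⊆ J (lift a≈0) = ≈0⇒∈ J a≈0

  _∶_ : Ideal → Carrier → Ideal
  J ∶ a = record
    { Member    = λ s → a * s ∈ J
    ; ∈-resp-≈  = λ s≈t → ∈-resp-≈ J (*-congˡ s≈t)
    ; 0∈        = ≈0⇒∈ J (zeroʳ a)
    ; +-closed  = λ {s} {t} as∈J at∈J → ∈-resp-≈ J (sym (distribˡ a s t)) (+-closed J as∈J at∈J)
    ; *-closedˡ = λ r {s} as∈J → ∈-resp-≈ J (x∙yz≈y∙xz r a s) (*-closedˡ J r as∈J)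
    }

  combination : {A : Set} → (A → Carrier) → List (A × Carrier) → Carrier
  combination h L = ∑ L (λ p → proj₂ p * h (proj₁ p))

  combination-∈ : ∀ {A : Set} (h : A → Carrier) J → (∀ x → h x ∈ J) → ∀ L → combination h L ∈ J
  combination-∈ h J h∈J L = ∑-closed J _ L (λ p → *-closedˡ J (proj₂ p) (h∈J (proj₁ p)))

  _+⟨_⟩ : Ideal → {A : Set} → (A → Carrier) → Ideal
  _+⟨_⟩ J {A} h = record
    { Member    = λ s → ∃₂ λ j L → j ∈ J × s ≈ j + combination h L
    ; ∈-resp-≈  = λ { a≈b (j , L , j∈J , a≈) → j , L , j∈J , trans (sym a≈b) a≈ }
    ; 0∈        = 0# , [] , 0∈ J , sym (+-identityʳ 0#)
    ; +-closed  = λ { {a} {b} (j , L , j∈J , a≈) (k , M , k∈J , b≈) →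
        j + k , L ++ M , +-closed J j∈J k∈J , (begin
          a + b                                               ≈⟨ +-cong a≈ b≈ ⟩
          (j + combination h L) + (k + combination h M)       ≈⟨ interchange _ _ _ _ ⟩
          (j + k) + (combination h L + combination h M)       ≈⟨ +-congˡ (sym (∑-++ _ L M)) ⟩
          (j + k) + combination h (L ++ M)                    ∎) }
    ; *-closedˡ = λ { r {a} (j , L , j∈J , a≈) →
        r * j , scale r L , *-closedˡ J r j∈J , (begin
          r * a                                    ≈⟨ *-congˡ a≈ ⟩
          r * (j + combination h L)                ≈⟨ distribˡ r j _ ⟩
          r * j + r * combination h L              ≈⟨ +-congˡ (sym (combination-scale r L)) ⟩
          r * j + combination h (scale r L)        ∎) }
    }
    where
    scale : Carrier → List (A × Carrier) → List (A × Carrier)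
    scale r = map (λ p → proj₁ p , r * proj₂ p)

    combination-scale : ∀ r L → combination h (scale r L) ≈ r * combination h L
    combination-scale r L = begin
      combination h (scale r L)                   ≡⟨ ∑-map _ _ L ⟩
      ∑ L (λ p → (r * proj₂ p) * h (proj₁ p))     ≈⟨ ∑-cong L (λ p → *-assoc r (proj₂ p) (h (proj₁ p))) ⟩
      ∑ L (λ p → r * (proj₂ p * h (proj₁ p)))     ≈⟨ ∑-distribˡ-* r _ L ⟩
      r * combination h L                         ∎

  module _ {A : Set} (h : A → Carrier) where

    gen∈+⟨⟩ : ∀ J x → h x ∈ J +⟨ h ⟩
    gen∈+⟨⟩ J x = 0# , (x , 1#) ∷ [] , 0∈ J ,
      sym (trans (+-identityˡ _) (trans (+-identityʳ _) (*-identityˡ (h x))))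

    ⊆+⟨⟩ : ∀ J → J ⊆ J +⟨ h ⟩
    ⊆+⟨⟩ J {a} a∈J = a , [] , a∈J , sym (+-identityʳ a)

    +⟨⟩-mono : ∀ J K → J ⊆ K → J +⟨ h ⟩ ⊆ K +⟨ h ⟩
    +⟨⟩-mono J K J⊆K (j , L , j∈J , a≈) = j , L , J⊆K j∈J , a≈

    +⟨⟩-least : ∀ J K → (∀ x → h x ∈ K) → J ⊆ K → J +⟨ h ⟩ ⊆ K
    +⟨⟩-least J K h∈K J⊆K (j , L , j∈J , a≈) =
      ∈-resp-≈ K (sym a≈) (+-closed K (J⊆K j∈J) (combination-∈ h K h∈K L))

  Unimodular : {A : Set} → (A → Carrier) → Set (c ⊔ ℓ)
  Unimodular h = ∃ λ L → combination h L ≈ 1#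

  unimodular⇒1∈+⟨⟩ : ∀ {A : Set} {h : A → Carrier} J → Unimodular h → 1# ∈ J +⟨ h ⟩
  unimodular⇒1∈+⟨⟩ J (L , L≈1) = 0# , L , 0∈ J , sym (trans (+-identityˡ _) L≈1)

  1∈0ᴵ+⟨⟩⇒unimodular : ∀ {A : Set} {h : A → Carrier} → 1# ∈ 0ᴵ +⟨ h ⟩ → Unimodular h
  1∈0ᴵ+⟨⟩⇒unimodular (j , L , lift j≈0 , 1≈) =
    L , sym (trans 1≈ (trans (+-congʳ j≈0) (+-identityˡ _)))

  annihilator-∈ : ∀ {A : Set} {J a} (g : A → Carrier) →
                  (∀ x → a * g x ∈ J) → 1# ∈ J +⟨ g ⟩ → a ∈ J
  annihilator-∈ {J = J} {a} g ag∈J 1∈ =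
    ∈-resp-≈ J (*-identityʳ a) (+⟨⟩-least g J (J ∶ a) ag∈J (*-closedˡ J a) 1∈)

  1≡x⇒1≡x^k : ∀ J {j x} k → j ∈ J → 1# ≈ j + x → ∃ λ j′ → j′ ∈ J × 1# ≈ j′ + x ^ k
  1≡x⇒1≡x^k J zero _ _ = 0# , 0∈ J , sym (+-identityˡ 1#)
  1≡x⇒1≡x^k J {j} {x} (suc k) j∈J 1≈ with 1≡x⇒1≡x^k J k j∈J 1≈
  ... | jₖ , jₖ∈J , 1≈ₖ = j + x * jₖ , +-closed J j∈J (*-closedˡ J x jₖ∈J) , (begin
    1#                            ≈⟨ 1≈ ⟩
    j + x                         ≈⟨ +-congˡ (sym (*-identityʳ x)) ⟩
    j + x * 1#                    ≈⟨ +-congˡ (*-congˡ 1≈ₖ) ⟩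
    j + x * (jₖ + x ^ k)          ≈⟨ +-congˡ (distribˡ x jₖ (x ^ k)) ⟩
    j + (x * jₖ + x * x ^ k)      ≈⟨ sym (+-assoc j _ _) ⟩
    (j + x * jₖ) + x ^ suc k      ∎)

  nilpotent-unit : ∀ J {j r a} m → a ^ m ∈ J → j ∈ J → 1# ≈ j + r * a → 1# ∈ J
  nilpotent-unit J {r = r} {a} m a^m∈J j∈J 1≈ with 1≡x⇒1≡x^k J m j∈J 1≈
  ... | j′ , j′∈J , 1≈′ = ∈-resp-≈ J (sym 1≈′) (+-closed J j′∈J
        (∈-resp-≈ J (sym (^-distrib-* r a m)) (*-closedˡ J (r ^ m) a^m∈J)))

  combination-const : ∀ a (L : List (⊤ × Carrier)) → combination (λ _ → a) L ≈ ∑ L proj₂ * a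
  combination-const a []      = sym (zeroˡ a)
  combination-const a (p ∷ L) = trans (+-congˡ (combination-const a L)) (sym (distribʳ a (proj₂ p) _))

  nilpotent-elim : ∀ {A : Set} (h : A → Carrier) J →
                   (∀ x → ∃ λ m → h x ^ m ∈ J) → 1# ∈ J +⟨ h ⟩ → 1# ∈ J
  nilpotent-elim h J nil (j , L , j∈J , 1≈) = go L J nil j∈J 1≈
    where
    go : ∀ L J → (∀ x → ∃ λ m → h x ^ m ∈ J) → ∀ {j} → j ∈ J → 1# ≈ j + combination h L → 1# ∈ J
    go []            J nil j∈J 1≈ = ∈-resp-≈ J (sym (trans 1≈ (+-identityʳ _))) j∈J
    go ((x , q) ∷ L) J nil {j} j∈J 1≈ =
      let k , M , k∈J , 1≈′ = go L K nilK j+qhx∈K (trans 1≈ (sym (+-assoc j (q * h x) _)))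
      in  nilpotent-unit J (proj₁ (nil x)) (proj₂ (nil x)) k∈J
            (trans 1≈′ (+-congˡ (combination-const (h x) M)))
      where
      K = J +⟨ (λ (_ : ⊤) → h x) ⟩
      nilK : ∀ y → ∃ λ m → h y ^ m ∈ K
      nilK y = proj₁ (nil y) , ⊆+⟨⟩ _ J (proj₂ (nil y))
      j+qhx∈K : j + q * h x ∈ K
      j+qhx∈K = +-closed K (⊆+⟨⟩ _ J j∈J) (*-closedˡ K q (gen∈+⟨⟩ _ J _))

  -- Gauss's lemma in the free algebra S⟨0,1⟩

  _∗_ : (List Bool → Carrier) → (List Bool → Carrier) → List Bool → Carrier
  (f ∗ g) z = ∑ (splits z) (λ p → f (proj₁ p) * g (proj₂ p))

  DegreeBelow : Ideal → ℕ → (List Bool → Carrier) → Set (c ⊔ ℓ)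
  DegreeBelow J n f = ∀ u → n ≤ length u → f u ∈ J

  ∑splits-∈ : ∀ J z (F : List Bool × List Bool → Carrier) →
              (∀ u v → length u +ℕ length v ≡ length z → F (u , v) ∈ J) → ∑ (splits z) F ∈ J
  ∑splits-∈ J []      F F∈J = +-closed J (F∈J [] [] ≡.refl) (0∈ J)
  ∑splits-∈ J (b ∷ z) F F∈J = +-closed J (F∈J [] (b ∷ z) ≡.refl)
    (≡.subst (_∈ J) (≡.sym (∑-map F _ (splits z)))
      (∑splits-∈ J z (λ p → F (b ∷ proj₁ p , proj₂ p)) (λ u v e → F∈J (b ∷ u) v (≡.cong suc e))))

  -- Among the splittings of x ++ y, all but (x , y) have a longer left or a longer right part.
  splits-++-term-∈ : ∀ J x y (F : List Bool × List Bool → Carrier) →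
    (∀ u v → length x < length u → F (u , v) ∈ J) →
    (∀ u v → length y < length v → F (u , v) ∈ J) →
    ∑ (splits (x ++ y)) F ∈ J → F (x , y) ∈ J
  splits-++-term-∈ J [] [] F _ _ ∑∈J = ∈-cancelʳ J (0∈ J) ∑∈J
  splits-++-term-∈ J [] (b ∷ y) F x< _ ∑∈J = ∈-cancelʳ J
    (≡.subst (_∈ J) (≡.sym (∑-map F _ (splits y)))
      (∑-closed J _ (splits y) (λ p → x< (b ∷ proj₁ p) (proj₂ p) (s≤s z≤n))))
    ∑∈J
  splits-++-term-∈ J (b ∷ x) y F x< y< ∑∈J =
    splits-++-term-∈ J x y (λ p → F (b ∷ proj₁ p , proj₂ p))
      (λ u v l → x< (b ∷ u) v (s≤s l)) (λ u v l → y< (b ∷ u) v l)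
      (≡.subst (_∈ J) (∑-map F _ (splits (x ++ y)))
        (∈-cancelˡ J (y< [] (b ∷ x ++ y) (s≤s (length-++-≤ʳ y {x}))) ∑∈J))

  -- For |v| = m the only term of (f ∗ g)(x ++ v) not already in J is f x * g v, so f x * g
  -- has degree below m; induct on m.
  top-coeff-annihilates : ∀ J f x → DegreeBelow J (suc (length x)) f →
    ∀ m g → DegreeBelow J m g → (∀ z → (f ∗ g) z ∈ J) → ∀ y → f x ^ m * g y ∈ J
  top-coeff-annihilates J f x f<|x| zero g g<m fg∈J y =
    ∈-resp-≈ J (sym (*-identityˡ (g y))) (g<m y z≤n)
  top-coeff-annihilates J f x f<|x| (suc m) g g<m fg∈J y =
    ∈-resp-≈ J (x∙yz≈yx∙z (f x ^ m) (f x) (g y))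
      (top-coeff-annihilates J f x f<|x| m fxg fxg<m fxg∈J y)
    where
    fxg : List Bool → Carrier
    fxg v = f x * g v
    fxg<m : DegreeBelow J m fxg
    fxg<m v m≤|v| with m≤n⇒m<n∨m≡n m≤|v|
    ... | inj₁ m<|v| = *-closedˡ J (f x) (g<m v m<|v|)
    ... | inj₂ m≡|v| = splits-++-term-∈ J x v _
      (λ u v′ |x|<|u| → ∈-resp-≈ J (*-comm _ _)
          (*-closedˡ J _ (f<|x| u |x|<|u|)))
      (λ u v′ |v|<|v′| → *-closedˡ J _ (g<m v′ (≡.subst (_< length v′) (≡.sym m≡|v|) |v|<|v′|)))
      (fg∈J (x ++ v))
    fxg∈J : ∀ z → (f ∗ fxg) z ∈ J
    fxg∈J z = ∈-resp-≈ J
      (sym (trans (∑-cong (splits z) (λ p → x∙yz≈y∙xz (f (proj₁ p)) (f x) (g (proj₂ p))))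
                  (∑-distribˡ-* (f x) _ (splits z))))
      (*-closedˡ J (f x) (fg∈J z))

  gauss : ∀ J f g m n → DegreeBelow J n f → DegreeBelow J m g → (∀ z → (f ∗ g) z ∈ J) →
          1# ∈ J +⟨ f ⟩ → 1# ∈ J +⟨ g ⟩ → 1# ∈ J
  gauss J f g m zero    f<0 _ _ f-unit _ = +⟨⟩-least f J J (λ u → f<0 u z≤n) id f-unit
  gauss J f g m (suc n) f<n g<m fg∈J f-unit g-unit =
    nilpotent-elim top J top-nilpotent
      (gauss J′ f g m n f<n′ (λ v l → J⊆J′ (g<m v l)) (λ z → J⊆J′ (fg∈J z))
        (+⟨⟩-mono f J J′ J⊆J′ f-unit) (+⟨⟩-mono g J J′ J⊆J′ g-unit))
    where
    top : Σ (List Bool) (λ x → length x ≡ n) → Carrier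
    top (x , _) = f x
    J′ = J +⟨ top ⟩
    J⊆J′ : J ⊆ J′
    J⊆J′ = ⊆+⟨⟩ top J
    f<n′ : DegreeBelow J′ n f
    f<n′ u n≤|u| with m≤n⇒m<n∨m≡n n≤|u|
    ... | inj₁ n<|u| = J⊆J′ (f<n u n<|u|)
    ... | inj₂ n≡|u| = gen∈+⟨⟩ top J (u , ≡.sym n≡|u|)
    top-nilpotent : ∀ p → ∃ λ k → top p ^ k ∈ J
    top-nilpotent (x , ≡.refl) =
      m , annihilator-∈ {J = J} g (top-coeff-annihilates J f x f<n m g g<m fg∈J) g-unit

  -- Sums over all words

  SupportedAt : List Bool → (List Bool → Carrier) → Set ℓ
  SupportedAt y F = ∀ x → x ≢ y → F x ≈ 0#

  pairs : (List Bool → Carrier) → List Bool → Carrier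
  pairs F w = F (false ∷ w) + F (true ∷ w)

  ∑-concatMap-pairs : ∀ ws F → ∑ (concatMap (λ w → (false ∷ w) ∷ (true ∷ w) ∷ []) ws) F ≈ ∑ ws (pairs F)
  ∑-concatMap-pairs []       F = refl
  ∑-concatMap-pairs (w ∷ ws) F =
    trans (+-congˡ (+-congˡ (∑-concatMap-pairs ws F))) (sym (+-assoc _ _ _))

  pairs-supported : ∀ {b y F} → SupportedAt (b ∷ y) F → SupportedAt y (pairs F)
  pairs-supported F-at x x≢y =
    trans (+-cong (F-at _ (x≢y ∘ ∷-injectiveʳ)) (F-at _ (x≢y ∘ ∷-injectiveʳ))) (+-identityˡ 0#)

  pairs-at : ∀ b {y F} → SupportedAt (b ∷ y) F → pairs F y ≈ F (b ∷ y)
  pairs-at false F-at = trans (+-congˡ (F-at _ (λ ()))) (+-identityʳ _)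
  pairs-at true  F-at = trans (+-congʳ (F-at _ (λ ()))) (+-identityˡ _)

  ∑-words-supported : ∀ n y F → SupportedAt y F → length y ≡ n → ∑ (words n) F ≈ F y
  ∑-words-supported zero    []      F F-at _ = +-identityʳ _
  ∑-words-supported (suc n) (b ∷ y) F F-at |y|≡n =
    trans (∑-concatMap-pairs (words n) F)
      (trans (∑-words-supported n y (pairs F) (pairs-supported F-at) (suc-injective |y|≡n))
             (pairs-at b F-at))

  ∑-words-unsupported : ∀ n y F → SupportedAt y F → length y ≢ n → ∑ (words n) F ≈ 0#
  ∑-words-unsupported zero    y       F F-at |y|≢0 =
    trans (+-identityʳ _) (F-at [] (λ e → |y|≢0 (≡.cong length (≡.sym e))))
  ∑-words-unsupported (suc n) []      F F-at _ =
    trans (∑-concatMap-pairs (words n) F)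
      (∑-zero (words n) (λ w → trans (+-cong (F-at _ (λ ())) (F-at _ (λ ()))) (+-identityˡ 0#)))
  ∑-words-unsupported (suc n) (b ∷ y) F F-at |y|≢n =
    trans (∑-concatMap-pairs (words n) F)
      (∑-words-unsupported n y (pairs F) (pairs-supported F-at) (λ e → |y|≢n (≡.cong suc e)))

  ∑-wordsBelow-unsupported : ∀ N y F → SupportedAt y F → N ≤ length y → ∑ (wordsBelow N) F ≈ 0#
  ∑-wordsBelow-unsupported zero    y F F-at _ = refl
  ∑-wordsBelow-unsupported (suc N) y F F-at N<|y| =
    trans (∑-++ F (wordsBelow N) (words N))
      (trans (+-cong (∑-wordsBelow-unsupported N y F F-at (<⇒≤ N<|y|))
                     (∑-words-unsupported N y F F-at (λ e → <⇒≢ N<|y| (≡.sym e))))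
             (+-identityˡ 0#))

  ∑-wordsBelow-supported : ∀ N y F → SupportedAt y F → (N ≤ length y → F y ≈ 0#) →
                           ∑ (wordsBelow N) F ≈ F y
  ∑-wordsBelow-supported zero    y F F-at Fy≈0 = sym (Fy≈0 z≤n)
  ∑-wordsBelow-supported (suc N) y F F-at Fy≈0 with length y ≟ℕ N
  ... | yes |y|≡N = trans (∑-++ F (wordsBelow N) (words N))
    (trans (+-cong (∑-wordsBelow-unsupported N y F F-at (≤-reflexive (≡.sym |y|≡N)))
                   (∑-words-supported N y F F-at |y|≡N))
           (+-identityˡ _))
  ... | no |y|≢N = trans (∑-++ F (wordsBelow N) (words N))
    (trans (+-cong (∑-wordsBelow-supported N y F F-at (λ N≤|y| → Fy≈0 (≤∧≢⇒< N≤|y| (λ e → |y|≢N (≡.sym e)))))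
                   (∑-words-unsupported N y F F-at |y|≢N))
           (+-identityʳ _))

  ==-refl : ∀ x → (x == x) ≡ true
  ==-refl x = dec-true (≡-dec _≟B_ x x) ≡.refl

  ==-≢ : ∀ {x y} → x ≢ y → (x == y) ≡ false
  ==-≢ {x} {y} = dec-false (≡-dec _≟B_ x y)

  coefficients : List (List Bool × Carrier) → List Bool → Carrier
  coefficients L x = ∑ L (λ p → if proj₁ p == x then proj₂ p else 0#)

  ∑-coefficients : ∀ N (G : List Bool → Carrier) → (∀ y → N ≤ length y → G y ≈ 0#) →
                   ∀ L → ∑ (wordsBelow N) (λ x → coefficients L x * G x) ≈ combination G L
  ∑-coefficients N G G≈0 []            = ∑-zero (wordsBelow N) (λ x → zeroˡ (G x))
  ∑-coefficients N G G≈0 ((y , r) ∷ L) =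
    trans (∑-cong (wordsBelow N) (λ x → distribʳ (G x) _ _))
      (trans (∑-distrib-+ _ _ (wordsBelow N))
        (+-cong (trans (∑-wordsBelow-supported N y F F-at Fy≈0) Fy) (∑-coefficients N G G≈0 L)))
    where
    F : List Bool → Carrier
    F x = (if y == x then r else 0#) * G x
    Fy : F y ≈ r * G y
    Fy rewrite ==-refl y = refl
    F-at : SupportedAt y F
    F-at x x≢y rewrite ==-≢ (λ y≡x → x≢y (≡.sym y≡x)) = zeroˡ (G x)
    Fy≈0 : N ≤ length y → F y ≈ 0#
    Fy≈0 N≤|y| = trans Fy (trans (*-congˡ (G≈0 y N≤|y|)) (zeroʳ r))

  -- Unimodular vectors

  coeff-in : ∀ ψ x → length x < bound ψ → coeff ψ x ≡ raw ψ x
  coeff-in ψ x |x|<b with length x <ᵇ bound ψ | <ᵇ-reflects-< (length x) (bound ψ)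
  ... | true  | _        = ≡.refl
  ... | false | ofⁿ |x|≮b = ⊥-elim (|x|≮b |x|<b)

  coeff-out : ∀ ψ x → bound ψ ≤ length x → coeff ψ x ≈ 0#
  coeff-out ψ x b≤|x| with length x <ᵇ bound ψ | <ᵇ-reflects-< (length x) (bound ψ)
  ... | false | _        = refl
  ... | true  | ofʸ |x|<b = ⊥-elim (<⇒≱ |x|<b b≤|x|)

  coeff-∈ : ∀ ψ J → (∀ z → raw ψ z ∈ J) → ∀ z → coeff ψ z ∈ J
  coeff-∈ ψ J raw∈J z with length z <ᵇ bound ψ
  ... | true  = raw∈J z
  ... | false = 0∈ J

  ⟨_⟩ : 𝒟 → Ideal
  ⟨ ψ ⟩ = 0ᴵ +⟨ coeff ψ ⟩

  ⊗-unimodularˡ : ∀ φ ψ → Unimodular (coeff (φ ⊗ ψ)) → Unimodular (coeff φ)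
  ⊗-unimodularˡ φ ψ φψ-unit = 1∈0ᴵ+⟨⟩⇒unimodular
    (+⟨⟩-least (coeff (φ ⊗ ψ)) 0ᴵ ⟨ φ ⟩ φψ∈⟨φ⟩ (0ᴵ⊆ ⟨ φ ⟩) (unimodular⇒1∈+⟨⟩ 0ᴵ φψ-unit))
    where
    φψ∈⟨φ⟩ : ∀ z → coeff (φ ⊗ ψ) z ∈ ⟨ φ ⟩
    φψ∈⟨φ⟩ = coeff-∈ (φ ⊗ ψ) ⟨ φ ⟩ (λ z → ∑-closed ⟨ φ ⟩ _ (splits z) (λ p →
      ∈-resp-≈ ⟨ φ ⟩ (*-comm _ _) (*-closedˡ ⟨ φ ⟩ _ (gen∈+⟨⟩ (coeff φ) 0ᴵ (proj₁ p)))))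

  ⊗-unimodularʳ : ∀ φ ψ → Unimodular (coeff (φ ⊗ ψ)) → Unimodular (coeff ψ)
  ⊗-unimodularʳ φ ψ φψ-unit = 1∈0ᴵ+⟨⟩⇒unimodular
    (+⟨⟩-least (coeff (φ ⊗ ψ)) 0ᴵ ⟨ ψ ⟩ φψ∈⟨ψ⟩ (0ᴵ⊆ ⟨ ψ ⟩) (unimodular⇒1∈+⟨⟩ 0ᴵ φψ-unit))
    where
    φψ∈⟨ψ⟩ : ∀ z → coeff (φ ⊗ ψ) z ∈ ⟨ ψ ⟩
    φψ∈⟨ψ⟩ = coeff-∈ (φ ⊗ ψ) ⟨ ψ ⟩ (λ z → ∑-closed ⟨ ψ ⟩ _ (splits z) (λ p →
      *-closedˡ ⟨ ψ ⟩ _ (gen∈+⟨⟩ (coeff ψ) 0ᴵ (proj₂ p))))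

  -- Beyond the bound of φ ⊗ ψ, every term of the product has a vanishing factor.
  ∗-∈⟨⊗⟩ : ∀ φ ψ z → (coeff φ ∗ coeff ψ) z ∈ ⟨ φ ⊗ ψ ⟩
  ∗-∈⟨⊗⟩ φ ψ z with length z <? bound φ +ℕ bound ψ
  ... | yes |z|<b = ≡.subst (_∈ ⟨ φ ⊗ ψ ⟩) (coeff-in (φ ⊗ ψ) z |z|<b) (gen∈+⟨⟩ (coeff (φ ⊗ ψ)) 0ᴵ z)
  ... | no  |z|≮b = ∑splits-∈ ⟨ φ ⊗ ψ ⟩ z _ term∈
    where
    term∈ : ∀ u v → length u +ℕ length v ≡ length z → coeff φ u * coeff ψ v ∈ ⟨ φ ⊗ ψ ⟩
    term∈ u v |u|+|v|≡|z| with length u <? bound φ | length v <? bound ψ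
    ... | no |u|≮b | _ = ≈0⇒∈ ⟨ φ ⊗ ψ ⟩ (trans (*-congʳ (coeff-out φ u (≮⇒≥ |u|≮b))) (zeroˡ _))
    ... | yes _ | no |v|≮b = ≈0⇒∈ ⟨ φ ⊗ ψ ⟩ (trans (*-congˡ (coeff-out ψ v (≮⇒≥ |v|≮b))) (zeroʳ _))
    ... | yes |u|<b | yes |v|<b =
      ⊥-elim (|z|≮b (≡.subst (_< bound φ +ℕ bound ψ) |u|+|v|≡|z| (+-mono-< |u|<b |v|<b)))

  ⊗-unimodular : ∀ φ ψ → Unimodular (coeff φ) → Unimodular (coeff ψ) → Unimodular (coeff (φ ⊗ ψ))
  ⊗-unimodular φ ψ φ-unit ψ-unit = 1∈0ᴵ+⟨⟩⇒unimodular
    (gauss ⟨ φ ⊗ ψ ⟩ (coeff φ) (coeff ψ) (bound ψ) (bound φ)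
      (λ u l → ≈0⇒∈ ⟨ φ ⊗ ψ ⟩ (coeff-out φ u l)) (λ v l → ≈0⇒∈ ⟨ φ ⊗ ψ ⟩ (coeff-out ψ v l))
      (∗-∈⟨⊗⟩ φ ψ) (unimodular⇒1∈+⟨⟩ ⟨ φ ⊗ ψ ⟩ φ-unit) (unimodular⇒1∈+⟨⟩ ⟨ φ ⊗ ψ ⟩ ψ-unit))

  ket-unimodular : ∀ x → Unimodular (coeff (ket x))
  ket-unimodular x = (x , 1#) ∷ [] , (begin
    1# * coeff (ket x) x + 0#   ≈⟨ +-identityʳ _ ⟩
    1# * coeff (ket x) x        ≈⟨ *-identityˡ _ ⟩
    coeff (ket x) x             ≡⟨ coeff-in (ket x) x (n<1+n (length x)) ⟩
    raw (ket x) x               ≡⟨ ≡.cong (if_then 1# else 0#) (==-refl x) ⟩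
    1#                          ∎)

  zero-not-unimodular : ¬ (1# ≈ 0#) → ∀ ψ → ψ ≈𝒟 zero𝒟 → ¬ Unimodular (coeff ψ)
  zero-not-unimodular 1≉0 ψ ψ≈0 (L , L≈1) = 1≉0 (trans (sym L≈1)
    (∑-zero L (λ p → trans (*-congˡ (trans (ψ≈0 (proj₁ p)) (coeff-out zero𝒟 (proj₁ p) z≤n))) (zeroʳ _))))

  module _ (conj : Carrier → Carrier) where
    open WithConj conj

    𝒮*⇒unimodular : ∀ ψ → 𝒮* ψ → Unimodular (coeff ψ)
    𝒮*⇒unimodular ψ (φ , ⟨φ∣ψ⟩≈1) =
      map (λ x → x , conj (coeff φ x)) (wordsBelow (bound φ ⊔ℕ bound ψ)) ,
      trans (reflexive (∑-map _ _ (wordsBelow (bound φ ⊔ℕ bound ψ)))) ⟨φ∣ψ⟩≈1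

    unimodular⇒𝒮* : (∀ s → conj (conj s) ≈ s) → ∀ ψ → Unimodular (coeff ψ) → 𝒮* ψ
    unimodular⇒𝒮* conj-involutive ψ (L , L≈1) = φ , (begin
      ∑ W (λ x → conj (coeff φ x) * coeff ψ x)       ≈⟨ ∑-cong W (λ x → conj-coeff (length x <ᵇ bound ψ) (raw ψ x)) ⟩
      ∑ W (λ x → coefficients L x * coeff ψ x)       ≈⟨ ∑-coefficients N (coeff ψ) coeff-out-N L ⟩
      combination (coeff ψ) L                        ≈⟨ L≈1 ⟩
      1#                                             ∎)
      where
      φ : 𝒟
      φ = mk𝒟 (bound ψ) (λ x → conj (coefficients L x))
      N = bound ψ ⊔ℕ bound ψ
      W = wordsBelow N
      coeff-out-N : ∀ y → N ≤ length y → coeff ψ y ≈ 0#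
      coeff-out-N y l = coeff-out ψ y (≤-trans (m≤m⊔n (bound ψ) (bound ψ)) l)
      conj-coeff : ∀ b {r} s → conj (if b then conj r else 0#) * (if b then s else 0#)
                              ≈ r * (if b then s else 0#)
      conj-coeff true  s = *-congʳ (conj-involutive _)
      conj-coeff false s = trans (zeroʳ _) (sym (zeroʳ _))

    𝒮*-isStateSpace : (∀ s → conj (conj s) ≈ s) → ¬ (1# ≈ 0#) → IsStateSpace 𝒮*
    𝒮*-isStateSpace conj-involutive 1≉0 = record
      { tensorˡ = λ ψ ψ∈ φ →
          (λ φψ∈ → state φ (⊗-unimodularˡ φ ψ (unimodular _ φψ∈))) ,
          (λ φ∈ → state _ (⊗-unimodular φ ψ (unimodular φ φ∈) (unimodular ψ ψ∈)))
      ; tensorʳ = λ ψ ψ∈ φ →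
          (λ ψφ∈ → state φ (⊗-unimodularʳ ψ φ (unimodular _ ψφ∈))) ,
          (λ φ∈ → state _ (⊗-unimodular ψ φ (unimodular ψ ψ∈) (unimodular φ φ∈)))
      ; kets    = λ x → state (ket x) (ket-unimodular x)
      ; noZero  = λ ψ ψ≈0 ψ∈ → zero-not-unimodular 1≉0 ψ ψ≈0 (unimodular ψ ψ∈)
      }
      where
      unimodular : ∀ ψ → 𝒮* ψ → Unimodular (coeff ψ)
      unimodular = 𝒮*⇒unimodular
      state : ∀ ψ → Unimodular (coeff ψ) → 𝒮* ψ
      state = unimodular⇒𝒮* conj-involutive

mainTheorem9 : ∀ {c ℓ} (R : CommutativeRing c ℓ)
    (conj : CommutativeRing.Carrier R → CommutativeRing.Carrier R) →
    IsConjugation R conj →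
    ¬ (CommutativeRing._≈_ R (CommutativeRing.1# R) (CommutativeRing.0# R)) →
    Qubits.IsStateSpace R (Qubits.WithConj.𝒮* R conj)
mainTheorem9 R conj isConjugation 1≉0 =
  𝒮*-isStateSpace R conj (IsConjugation.involutive isConjugation) 1≉0
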